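{- If $n_1\geq n_2\geq n_3\ge 2$ and $n = n_1 + n_2 + n_3$, then \[ {\rm ex}(\mathcal{K}_{n_1,n_2,n_3}^{(3)}, F_3) = \begin{cases} n - 4, & n_3 = 2, \\ n - 5, & n_3 = 3, \\ n - 6, & n_3\ge 4. \end{cases} \]
   Context: $\mathcal{K}_{n_1,\dots,n_r}^{(r)}$ is the complete $r$-partite $r$-uniform hypergraph: vertex set $V_1\cup\cdots\cup V_r$ with pairwise disjoint parts, $|V_i|=n_i$, and edges all sets $e$ with $|e\cap V_i|=1$ for every $i$. For $r\ge 2$, $F_r$ is the $r$-uniform hypergraph on $r+2$ vertices consisting of two edges $f_1,f_2$ with $|f_1\cap f_2| = r-2$. ${\rm ex}(\mathcal{K}_{n_1,\dots,n_r}^{(r)}, F_r)$ is the maximum number of edges of a subhypergraph of $\mathcal{K}_{n_1,\dots,n_r}^{(r)}$ containing no subhypergraph isomorphic to $F_r$ (equivalently, a family of edges no two of which intersect in exactly $r-2$ vertices). -}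

module Defs where

open import Data.Nat using (ℕ; zero; suc; _+_; _∸_; _≤_)
open import Data.Fin using (Fin)
open import Data.Fin.Properties using () renaming (_≟_ to _≟ᶠ_)
open import Data.Product using (_×_; _,_; ∃-syntax)
open import Data.List using (List; length)
open import Data.List.Membership.Propositional using (_∈_)
open import Data.List.Relation.Unary.Unique.Propositional using (Unique)
open import Relation.Nullary using (Dec; yes; no; ¬_)
open import Relation.Binary.PropositionalEquality using (_≡_)

-- An edge of the complete 3-partite 3-uniform hypergraph K^{(3)}_{n1,n2,n3}:
-- one vertex from each part V1 = Fin n1, V2 = Fin n2, V3 = Fin n3.
Edge : ℕ → ℕ → ℕ → Set
Edge n₁ n₂ n₃ = Fin n₁ × Fin n₂ × Fin n₃

eqInd : ∀ {m} → Fin m → Fin m → ℕ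
eqInd x y with x ≟ᶠ y
... | yes _ = 1
... | no _  = 0

-- |e ∩ f| for two edges (parts are disjoint, so common vertices lie in the same part)
∣_∩_∣ : ∀ {n₁ n₂ n₃} → Edge n₁ n₂ n₃ → Edge n₁ n₂ n₃ → ℕ
∣ (a₁ , a₂ , a₃) ∩ (b₁ , b₂ , b₃) ∣ = eqInd a₁ b₁ + eqInd a₂ b₂ + eqInd a₃ b₃

-- A subhypergraph (set of edges, given as a duplicate-free list) is F_3-free
-- iff no two of its edges intersect in exactly r - 2 = 1 vertex.
F₃-free : ∀ {n₁ n₂ n₃} → List (Edge n₁ n₂ n₃) → Set
F₃-free H = ∀ {e f} → e ∈ H → f ∈ H → ¬ (∣ e ∩ f ∣ ≡ 1)

IsEx : ℕ → ℕ → ℕ → ℕ → Set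
IsEx n₁ n₂ n₃ m =
  (∃[ H ] (Unique H × F₃-free {n₁} {n₂} {n₃} H × length H ≡ m))
  × (∀ (H : List (Edge n₁ n₂ n₃)) → Unique H → F₃-free H → length H ≤ m)

exValue : ℕ → ℕ → ℕ → ℕ
exValue n₁ n₂ 2 = (n₁ + n₂ + 2) ∸ 4
exValue n₁ n₂ 3 = (n₁ + n₂ + 3) ∸ 5
exValue n₁ n₂ n₃ = (n₁ + n₂ + n₃) ∸ 6

module Submission where

-- In an F₃-free family H two distinct edges are either disjoint or share two vertices,
-- i.e. differ in exactly one part. All edges sharing two vertices with a given edge h
-- differ from h in the same part (two of them differing in distinct parts would meet in
-- exactly one vertex): this is the direction of h. Intersecting edges have the same
-- direction, and an edge of direction p is determined by its vertex in V_p. So for any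
-- family S of pairwise disjoint edges of H, each part V_p contains, all distinct, the
-- p-vertices of the edges of direction p and of the members of S of other directions;
-- summing over p gives |H| + 2|S| ≤ n. Three pairwise disjoint edges give |H| ≤ n - 6.
-- If a, b are disjoint but no three edges are, every edge meets a or b, so some part
-- V_k is the direction of no edge; counting in the other two parts gives
-- |H| ≤ n - 2 - n_k. If all edges meet, they share one direction p and |H| ≤ n_p.
-- Thus |H| ≤ n - 2 - min(n₃, 4), which is attained by two stars (n₃ ≤ 3) or three
-- stars (n₃ ≥ 4) on disjoint vertex sets.

open import Defs
open import Data.Nat using (ℕ; suc; _+_; _*_; _≤_; _⊓_; z≤n; s≤s)
open import Data.Nat.Properties hiding (_≟_; suc-injective)
open import Data.Nat.Tactic.RingSolver using (solve-∀)
open import Algebra.Properties.CommutativeSemigroup +-commutativeSemigroup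
  using (interchange; xy∙z≈yx∙z; xy∙z≈xz∙y; xy∙z≈zx∙y; xy∙z≈yz∙x; xy∙z≈zy∙x)
open import Data.Fin using (Fin; zero; suc; splitAt; join)
open import Data.Fin.Patterns using (0F; 1F; 2F)
open import Data.Fin.Properties using (join-splitAt; injective⇒≤; suc-injective; all?; any?; _≟_)
open import Data.Product using (_×_; _,_; ∃-syntax; proj₁; proj₂)
open import Data.Product.Properties using (×-≡,≡→≡)
open import Data.Sum using (_⊎_; inj₁; inj₂; fromInj₁)
open import Data.Sum.Properties using (inj₂-injective)
import Data.Sum as Sum
open import Data.List using (List; []; _∷_; length; map; filter; _++_; allFin; lookup)
import Data.List.Relation.Unary.Any as Any
open import Data.List.Properties using (length-map; length-++; length-tabulate; filter-all; filter-none)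
open import Data.List.Membership.Propositional using (_∈_; find; lose)
open import Data.List.Membership.Propositional.Properties using (∈-lookup; ∈-map⁻; ∈-filter⁻)
open import Data.List.Relation.Binary.Subset.Propositional using (_⊆_)
open import Data.List.Relation.Unary.Any using (here; there)
open import Data.List.Relation.Unary.All as All using (All; []; _∷_)
open import Data.List.Relation.Unary.AllPairs as AllPairs using (AllPairs; []; _∷_)
import Data.List.Relation.Unary.AllPairs.Properties as AllPairs
open import Data.List.Relation.Unary.Unique.Propositional using (Unique)
import Data.List.Relation.Unary.Unique.Propositional.Properties as Unique
open import Data.Empty using (⊥-elim)
open import Function using (_∘_; id)
open import Relation.Nullary using (Dec; yes; no; ¬_; ¬?; contradiction)
open import Relation.Nullary.Decidable using (_×-dec_; _→-dec_)
open import Relation.Unary using (Pred; Decidable)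
open import Relation.Binary.PropositionalEquality
  using (_≡_; _≢_; refl; sym; trans; cong; cong₂; subst; ≢-sym; module ≡-Reasoning)

lookup-injective : ∀ {A : Set} {xs : List A} → Unique xs →
  ∀ {i j} → lookup xs i ≡ lookup xs j → i ≡ j
lookup-injective (_ ∷ _)   {zero}  {zero}  _ = refl
lookup-injective (x∉ ∷ _)  {zero}  {suc j} e = contradiction e (All.lookup x∉ (∈-lookup j))
lookup-injective (x∉ ∷ _)  {suc i} {zero}  e = contradiction (sym e) (All.lookup x∉ (∈-lookup i))
lookup-injective (_ ∷ xs!) {suc i} {suc j} e = cong suc (lookup-injective xs! e)

Unique⇒length≤ : ∀ {m} {xs : List (Fin m)} → Unique xs → length xs ≤ m
Unique⇒length≤ xs! = injective⇒≤ (lookup-injective xs!)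

distinct-images⇒length≤ : ∀ {A : Set} {m} (f : A → Fin m) {xs : List A} →
  AllPairs (λ x y → f x ≢ f y) xs → length xs ≤ m
distinct-images⇒length≤ {m = m} f {xs} fxs! =
  subst (_≤ m) (length-map f xs) (Unique⇒length≤ (AllPairs.map⁺ fxs!))

AllPairs-map-∈ : ∀ {A : Set} {R S : A → A → Set} {xs : List A} →
  (∀ {x y} → x ∈ xs → y ∈ xs → R x y → S x y) → AllPairs R xs → AllPairs S xs
AllPairs-map-∈ R⇒S [] = []
AllPairs-map-∈ R⇒S (Rx ∷ Rxs) =
  All.tabulate (λ y∈ → R⇒S (here refl) (there y∈) (All.lookup Rx y∈))
  ∷ AllPairs-map-∈ (λ x∈ y∈ → R⇒S (there x∈) (there y∈)) Rxs

count : ∀ {P : Set} → Dec P → ℕ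
count (yes _) = 1
count (no _)  = 0

length-filter-∷ : ∀ {A : Set} {P : Pred A _} (P? : Decidable P) x xs →
  length (filter P? (x ∷ xs)) ≡ count (P? x) + length (filter P? xs)
length-filter-∷ P? x xs with P? x
... | yes _ = refl
... | no _  = refl

[]⊎∈ : ∀ {A : Set} (xs : List A) → xs ≡ [] ⊎ ∃[ x ] x ∈ xs
[]⊎∈ []      = inj₁ refl
[]⊎∈ (x ∷ _) = inj₂ (x , here refl)

Part : Set
Part = Fin 3

∑ : (Part → ℕ) → ℕ
∑ f = f 0F + f 1F + f 2F

third : Part → Part → Part
third 0F 1F = 2F
third 1F 0F = 2F
third 0F 2F = 1F
third 2F 0F = 1F
third 1F 2F = 0F
third 2F 1F = 0F
third 0F 0F = 1F
third 1F 1F = 0F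
third 2F 2F = 0F

third-≢ : ∀ p q → p ≢ third p q × q ≢ third p q
third-≢ 0F 1F = (λ ()) , (λ ())
third-≢ 1F 0F = (λ ()) , (λ ())
third-≢ 0F 2F = (λ ()) , (λ ())
third-≢ 2F 0F = (λ ()) , (λ ())
third-≢ 1F 2F = (λ ()) , (λ ())
third-≢ 2F 1F = (λ ()) , (λ ())
third-≢ 0F 0F = (λ ()) , (λ ())
third-≢ 1F 1F = (λ ()) , (λ ())
third-≢ 2F 2F = (λ ()) , (λ ())

third-surjective : ∀ k → ∃[ p ] ∃[ q ] (p ≢ q × third p q ≡ k)
third-surjective 0F = 1F , 2F , (λ ()) , refl
third-surjective 1F = 0F , 2F , (λ ()) , refl
third-surjective 2F = 0F , 1F , (λ ()) , refl

∑-third : ∀ (f : Part → ℕ) {p q} → p ≢ q → ∑ f ≡ f p + f q + f (third p q)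
∑-third f {0F} {1F} _ = refl
∑-third f {1F} {0F} _ = xy∙z≈yx∙z (f 0F) (f 1F) (f 2F)
∑-third f {0F} {2F} _ = xy∙z≈xz∙y (f 0F) (f 1F) (f 2F)
∑-third f {2F} {0F} _ = xy∙z≈zx∙y (f 0F) (f 1F) (f 2F)
∑-third f {1F} {2F} _ = xy∙z≈yz∙x (f 0F) (f 1F) (f 2F)
∑-third f {2F} {1F} _ = xy∙z≈zy∙x (f 0F) (f 1F) (f 2F)
∑-third f {0F} {0F} p≢q = contradiction refl p≢q
∑-third f {1F} {1F} p≢q = contradiction refl p≢q
∑-third f {2F} {2F} p≢q = contradiction refl p≢q

∑-+ : ∀ f g → ∑ (λ p → f p + g p) ≡ ∑ f + ∑ g
∑-+ f g = trans (cong (_+ (f 2F + g 2F)) (interchange (f 0F) (g 0F) (f 1F) (g 1F)))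
                (interchange (f 0F + f 1F) (g 0F + g 1F) (f 2F) (g 2F))

∑-mono-≤ : ∀ {f g} → (∀ p → f p ≤ g p) → ∑ f ≤ ∑ g
∑-mono-≤ f≤g = +-mono-≤ (+-mono-≤ (f≤g 0F) (f≤g 1F)) (f≤g 2F)

∑-≤-except : ∀ {f g} k → (∀ p → f p ≤ g p) → ∑ f + g k ≤ ∑ g + f k
∑-≤-except {f} {g} k f≤g with third-surjective k
... | p , q , p≢q , refl = begin
  ∑ f + g k                       ≡⟨ cong (_+ g k) (∑-third f p≢q) ⟩
  f p + f q + f k + g k           ≡⟨ +-assoc (f p + f q) (f k) (g k) ⟩
  f p + f q + (f k + g k)         ≤⟨ +-mono-≤ (+-mono-≤ (f≤g p) (f≤g q)) (≤-reflexive (+-comm (f k) (g k))) ⟩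
  g p + g q + (g k + f k)         ≡⟨ +-assoc (g p + g q) (g k) (f k) ⟨
  g p + g q + g k + f k           ≡⟨ cong (_+ f k) (∑-third g p≢q) ⟨
  ∑ g + f k                       ∎
  where open ≤-Reasoning

∑-cong : ∀ {f g} → (∀ p → f p ≡ g p) → ∑ f ≡ ∑ g
∑-cong f≡g = cong₂ _+_ (cong₂ _+_ (f≡g 0F) (f≡g 1F)) (f≡g 2F)

∑-length-filter : ∀ {A : Set} {P : Part → Pred A _} (P? : ∀ p → Decidable (P p)) {c} →
  (∀ x → ∑ (λ p → count (P? p x)) ≡ c) →
  ∀ xs → ∑ (λ p → length (filter (P? p) xs)) ≡ c * length xs
∑-length-filter P? {c} each [] = sym (*-zeroʳ c)
∑-length-filter P? {c} each (x ∷ xs) = begin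
  ∑ (λ p → length (filter (P? p) (x ∷ xs)))         ≡⟨ ∑-cong (λ p → length-filter-∷ (P? p) x xs) ⟩
  ∑ (λ p → count (P? p x) + length (filter (P? p) xs)) ≡⟨ ∑-+ (λ p → count (P? p x)) rest ⟩
  ∑ (λ p → count (P? p x)) + ∑ rest                 ≡⟨ cong₂ _+_ (each x) (∑-length-filter P? each xs) ⟩
  c + c * length xs                                 ≡⟨ *-suc c (length xs) ⟨
  c * length (x ∷ xs)                               ∎
  where
  open ≡-Reasoning
  rest : Part → ℕ
  rest p = length (filter (P? p) xs)

∑-length-filter-≡ : ∀ {A : Set} (f : A → Part) xs →
  ∑ (λ p → length (filter (λ x → f x ≟ p) xs)) ≡ length xs
∑-length-filter-≡ f xs =
  trans (∑-length-filter (λ p x → f x ≟ p) (λ x → once (f x)) xs) (*-identityˡ (length xs))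
  where
  once : ∀ q → ∑ (λ p → count (q ≟ p)) ≡ 1
  once 0F = refl
  once 1F = refl
  once 2F = refl

∑-length-filter-≢ : ∀ {A : Set} (f : A → Part) xs →
  ∑ (λ p → length (filter (λ x → ¬? (f x ≟ p)) xs)) ≡ 2 * length xs
∑-length-filter-≢ f = ∑-length-filter (λ p x → ¬? (f x ≟ p)) (λ x → twice (f x))
  where
  twice : ∀ q → ∑ (λ p → count (¬? (q ≟ p))) ≡ 2
  twice 0F = refl
  twice 1F = refl
  twice 2F = refl

eqInd-≡ : ∀ {m} {x y : Fin m} → x ≡ y → eqInd x y ≡ 1
eqInd-≡ {x = x} {y} x≡y with x ≟ y
... | yes _   = refl
... | no x≢y = contradiction x≡y x≢y

eqInd-≢ : ∀ {m} {x y : Fin m} → x ≢ y → eqInd x y ≡ 0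
eqInd-≢ {x = x} {y} x≢y with x ≟ y
... | yes x≡y = contradiction x≡y x≢y
... | no _    = refl

module Edges (n₁ n₂ n₃ : ℕ) where

  E : Set
  E = Edge n₁ n₂ n₃

  size : Part → ℕ
  size 0F = n₁
  size 1F = n₂
  size 2F = n₃

  coord : (p : Part) → E → Fin (size p)
  coord 0F = proj₁
  coord 1F = proj₁ ∘ proj₂
  coord 2F = proj₂ ∘ proj₂

  size≤n₁ : n₂ ≤ n₁ → n₃ ≤ n₂ → ∀ p → size p ≤ n₁
  size≤n₁ n₂≤n₁ n₃≤n₂ 0F = ≤-refl
  size≤n₁ n₂≤n₁ n₃≤n₂ 1F = n₂≤n₁
  size≤n₁ n₂≤n₁ n₃≤n₂ 2F = ≤-trans n₃≤n₂ n₂≤n₁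

  n₃≤size : n₂ ≤ n₁ → n₃ ≤ n₂ → ∀ p → n₃ ≤ size p
  n₃≤size n₂≤n₁ n₃≤n₂ 0F = ≤-trans n₃≤n₂ n₂≤n₁
  n₃≤size n₂≤n₁ n₃≤n₂ 1F = n₃≤n₂
  n₃≤size n₂≤n₁ n₃≤n₂ 2F = ≤-refl

  -- ∣ h ∩ g ∣ is definitionally ∑ (agreement h g).
  agreement : E → E → Part → ℕ
  agreement h g p = eqInd (coord p h) (coord p g)

  coord-ext : ∀ {h g} → (∀ p → coord p h ≡ coord p g) → h ≡ g
  coord-ext same = ×-≡,≡→≡ (same 0F , ×-≡,≡→≡ (same 1F , same 2F))

  Disjoint : E → E → Set
  Disjoint h g = ∀ p → coord p h ≢ coord p g

  Adjacent : Part → E → E → Set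
  Adjacent p h g = coord p h ≢ coord p g × (∀ q → q ≢ p → coord q h ≡ coord q g)

  disjoint? : ∀ h g → Dec (Disjoint h g)
  disjoint? h g = all? (λ p → ¬? (coord p h ≟ coord p g))

  adjacent? : ∀ p h g → Dec (Adjacent p h g)
  adjacent? p h g = ¬? (coord p h ≟ coord p g) ×-dec all? (λ q → ¬? (q ≟ p) →-dec (coord q h ≟ coord q g))

  Adjacent-sym : ∀ {p h g} → Adjacent p h g → Adjacent p g h
  Adjacent-sym (differ , agree) = differ ∘ sym , λ q q≢p → sym (agree q q≢p)

  two-disagreements⇒∣∩∣≡1 : ∀ {p q h g} → p ≢ q → coord p h ≢ coord p g → coord q h ≢ coord q g →
    coord (third p q) h ≡ coord (third p q) g → ∣ h ∩ g ∣ ≡ 1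
  two-disagreements⇒∣∩∣≡1 {p} {q} {h} {g} p≢q hp≢gp hq≢gq hr≡gr = begin
    ∣ h ∩ g ∣                                                ≡⟨ ∑-third (agreement h g) p≢q ⟩
    agreement h g p + agreement h g q + agreement h g (third p q)
      ≡⟨ cong₂ _+_ (cong₂ _+_ (eqInd-≢ hp≢gp) (eqInd-≢ hq≢gq)) (eqInd-≡ hr≡gr) ⟩
    1                                                        ∎
    where open ≡-Reasoning

  two-agreements⇒∣∩∣≢1 : ∀ {p q} h g → p ≢ q → coord p h ≡ coord p g → coord q h ≡ coord q g →
    ∣ h ∩ g ∣ ≢ 1
  two-agreements⇒∣∩∣≢1 {p} {q} h g p≢q hp≡gp hq≡gq ∣h∩g∣≡1 =
    contradiction (trans (sym ∣h∩g∣≡2+) ∣h∩g∣≡1) λ ()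
    where
    ∣h∩g∣≡2+ : ∣ h ∩ g ∣ ≡ 2 + agreement h g (third p q)
    ∣h∩g∣≡2+ = trans (∑-third (agreement h g) p≢q)
                     (cong₂ (λ a b → a + b + agreement h g (third p q)) (eqInd-≡ hp≡gp) (eqInd-≡ hq≡gq))

  Comparison : E → E → Set
  Comparison h g = (h ≡ g ⊎ Disjoint h g ⊎ ∃[ p ] Adjacent p h g) ⊎ ∣ h ∩ g ∣ ≡ 1

  compare-edges : ∀ h g → Comparison h g
  compare-edges h g = classify (agree? 0F) (agree? 1F) (agree? 2F)
    where
    agree? : ∀ p → Dec (coord p h ≡ coord p g)
    agree? p = coord p h ≟ coord p g
    classify : Dec (coord 0F h ≡ coord 0F g) → Dec (coord 1F h ≡ coord 1F g) →
               Dec (coord 2F h ≡ coord 2F g) → Comparison h g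
    classify (yes e₀) (yes e₁) (yes e₂) = inj₁ (inj₁ (coord-ext λ { 0F → e₀ ; 1F → e₁ ; 2F → e₂ }))
    classify (no d₀)  (no d₁)  (no d₂)  = inj₁ (inj₂ (inj₁ λ { 0F → d₀ ; 1F → d₁ ; 2F → d₂ }))
    classify (no d₀)  (yes e₁) (yes e₂) =
      inj₁ (inj₂ (inj₂ (0F , d₀ , λ { 0F 0≢0 → contradiction refl 0≢0 ; 1F _ → e₁ ; 2F _ → e₂ })))
    classify (yes e₀) (no d₁)  (yes e₂) =
      inj₁ (inj₂ (inj₂ (1F , d₁ , λ { 0F _ → e₀ ; 1F 1≢1 → contradiction refl 1≢1 ; 2F _ → e₂ })))
    classify (yes e₀) (yes e₁) (no d₂)  =
      inj₁ (inj₂ (inj₂ (2F , d₂ , λ { 0F _ → e₀ ; 1F _ → e₁ ; 2F 2≢2 → contradiction refl 2≢2 })))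
    classify (yes e₀) (no d₁)  (no d₂)  = inj₂ (two-disagreements⇒∣∩∣≡1 {1F} {2F} (λ ()) d₁ d₂ e₀)
    classify (no d₀)  (yes e₁) (no d₂)  = inj₂ (two-disagreements⇒∣∩∣≡1 {0F} {2F} (λ ()) d₀ d₂ e₁)
    classify (no d₀)  (no d₁)  (yes e₂) = inj₂ (two-disagreements⇒∣∩∣≡1 {0F} {1F} (λ ()) d₀ d₁ e₂)

module FreeFamily {n₁ n₂ n₃ : ℕ} {H : List (Edge n₁ n₂ n₃)} (H-unique : Unique H) (H-free : F₃-free H) where

  open Edges n₁ n₂ n₃

  compare∈ : ∀ {h g} → h ∈ H → g ∈ H → h ≡ g ⊎ Disjoint h g ⊎ ∃[ p ] Adjacent p h g
  compare∈ h∈ g∈ = fromInj₁ (⊥-elim ∘ H-free h∈ g∈) (compare-edges _ _)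

  adjacent-part-unique : ∀ {p q h g g′} → g ∈ H → g′ ∈ H → Adjacent p h g → Adjacent q h g′ → p ≡ q
  adjacent-part-unique {p} {q} {h} {g} {g′} g∈ g′∈ (hp≢gp , h~g) (hq≢g′q , h~g′) with p ≟ q
  ... | yes p≡q = p≡q
  ... | no p≢q  = contradiction (two-disagreements⇒∣∩∣≡1 p≢q gp≢g′p gq≢g′q gr≡g′r) (H-free g∈ g′∈)
    where
    r = third p q
    gp≢g′p : coord p g ≢ coord p g′
    gp≢g′p gp≡g′p = hp≢gp (trans (h~g′ p p≢q) (sym gp≡g′p))
    gq≢g′q : coord q g ≢ coord q g′
    gq≢g′q gq≡g′q = hq≢g′q (trans (h~g q (≢-sym p≢q)) gq≡g′q)
    gr≡g′r : coord r g ≡ coord r g′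
    gr≡g′r = trans (sym (h~g r (≢-sym (proj₁ (third-≢ p q))))) (h~g′ r (≢-sym (proj₂ (third-≢ p q))))

  -- The part in which the neighbours of h differ from h (arbitrarily 0F if it has none).
  dir : E → Part
  dir h with any? (λ p → Any.any? (adjacent? p h) H)
  ... | yes (p , _) = p
  ... | no _        = 0F

  adjacent⇒dir≡ : ∀ {p h g} → g ∈ H → Adjacent p h g → dir h ≡ p
  adjacent⇒dir≡ {p} {h} g∈ h~g with any? (λ p → Any.any? (adjacent? p h) H)
  ... | yes (q , ∃g′) = let g′ , g′∈ , h~g′ = find ∃g′ in adjacent-part-unique g′∈ g∈ h~g′ h~g
  ... | no ∄g′        = contradiction (p , lose g∈ h~g) ∄g′

  coord-dir-injective : ∀ {p h g} → h ∈ H → g ∈ H → dir h ≡ p → coord p h ≡ coord p g → h ≡ g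
  coord-dir-injective h∈ g∈ dir≡p same with compare∈ h∈ g∈
  ... | inj₁ h≡g               = h≡g
  ... | inj₂ (inj₁ disjoint)   = contradiction same (disjoint _)
  ... | inj₂ (inj₂ (q , h~g)) with trans (sym (adjacent⇒dir≡ g∈ h~g)) dir≡p
  ...   | refl = contradiction same (proj₁ h~g)

  intersecting⇒dir≡ : ∀ {h g} → h ∈ H → g ∈ H → ¬ Disjoint h g → dir h ≡ dir g
  intersecting⇒dir≡ h∈ g∈ meet with compare∈ h∈ g∈
  ... | inj₁ refl              = refl
  ... | inj₂ (inj₁ disjoint)   = contradiction disjoint meet
  ... | inj₂ (inj₂ (p , h~g))  = trans (adjacent⇒dir≡ g∈ h~g) (sym (adjacent⇒dir≡ h∈ (Adjacent-sym h~g)))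

  along : Part → List E
  along p = filter (λ h → dir h ≟ p) H

  across : Part → List E → List E
  across p S = filter (λ x → ¬? (dir x ≟ p)) S

  load : List E → Part → ℕ
  load S p = length (along p) + length (across p S)

  load-bound : ∀ {S} → S ⊆ H → AllPairs Disjoint S → ∀ p → load S p ≤ size p
  load-bound {S} S⊆H S-disjoint p =
    subst (_≤ size p) (length-++ (along p)) (distinct-images⇒length≤ (coord p) distinct)
    where
    ∈along⁻ : ∀ {x} → x ∈ along p → x ∈ H × dir x ≡ p
    ∈along⁻ = ∈-filter⁻ (λ h → dir h ≟ p)
    ∈across⁻ : ∀ {y} → y ∈ across p S → y ∈ S × dir y ≢ p
    ∈across⁻ = ∈-filter⁻ (λ x → ¬? (dir x ≟ p))
    along-distinct : AllPairs (λ x y → coord p x ≢ coord p y) (along p)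
    along-distinct = AllPairs-map-∈
      (λ x∈ y∈ x≢y same →
         x≢y (coord-dir-injective (proj₁ (∈along⁻ x∈)) (proj₁ (∈along⁻ y∈)) (proj₂ (∈along⁻ x∈)) same))
      (AllPairs.filter⁺ (λ h → dir h ≟ p) H-unique)
    across-distinct : AllPairs (λ x y → coord p x ≢ coord p y) (across p S)
    across-distinct =
      AllPairs.map (λ disjoint → disjoint p) (AllPairs.filter⁺ (λ x → ¬? (dir x ≟ p)) S-disjoint)
    along-across-distinct : ∀ {x y} → x ∈ along p → y ∈ across p S → coord p x ≢ coord p y
    along-across-distinct x∈ y∈ same
      with coord-dir-injective (proj₁ (∈along⁻ x∈)) (S⊆H (proj₁ (∈across⁻ y∈))) (proj₂ (∈along⁻ x∈)) same
    ... | refl = proj₂ (∈across⁻ y∈) (proj₂ (∈along⁻ x∈))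
    distinct : AllPairs (λ x y → coord p x ≢ coord p y) (along p ++ across p S)
    distinct = AllPairs.++⁺ along-distinct across-distinct
      (All.tabulate λ x∈ → All.tabulate λ y∈ → along-across-distinct x∈ y∈)

  ∑-load : ∀ S → ∑ (load S) ≡ length H + 2 * length S
  ∑-load S = trans (∑-+ (length ∘ along) (λ p → length (across p S)))
                   (cong₂ _+_ (∑-length-filter-≡ dir H) (∑-length-filter-≢ dir S))

  disjoint-triple⇒length+6≤ : ∀ {a b c} → a ∈ H → b ∈ H → c ∈ H →
    Disjoint a b → Disjoint a c → Disjoint b c → length H + 6 ≤ ∑ size
  disjoint-triple⇒length+6≤ {a} {b} {c} a∈ b∈ c∈ ab ac bc =
    subst (_≤ ∑ size) (∑-load (a ∷ b ∷ c ∷ []))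
          (∑-mono-≤ (load-bound S⊆H ((ab ∷ ac ∷ []) ∷ (bc ∷ []) ∷ [] ∷ [])))
    where
    S⊆H : (a ∷ b ∷ c ∷ []) ⊆ H
    S⊆H (here refl)                 = a∈
    S⊆H (there (here refl))         = b∈
    S⊆H (there (there (here refl))) = c∈

  covering-disjoint-pair⇒length+2+size≤ : ∀ {a b} → a ∈ H → b ∈ H → Disjoint a b →
    (∀ {h} → h ∈ H → ¬ Disjoint a h ⊎ ¬ Disjoint b h) → ∃[ k ] length H + 2 + size k ≤ ∑ size
  covering-disjoint-pair⇒length+2+size≤ {a} {b} a∈ b∈ ab covers = k , +-cancelʳ-≤ 2 _ _ (begin
    length H + 2 + size k + 2   ≡⟨ xy∙z≈xz∙y (length H + 2) (size k) 2 ⟩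
    length H + 2 + 2 + size k   ≡⟨ cong (_+ size k) (+-assoc (length H) 2 2) ⟩
    length H + 4 + size k       ≡⟨ cong (_+ size k) (∑-load S) ⟨
    ∑ (load S) + size k         ≤⟨ ∑-≤-except k (load-bound S⊆H ((ab ∷ []) ∷ [] ∷ [])) ⟩
    ∑ size + load S k           ≡⟨ cong (∑ size +_) (cong₂ _+_ (cong length along-k≡[]) (cong length across-k≡S)) ⟩
    ∑ size + 2                  ∎)
    where
    open ≤-Reasoning
    k = third (dir a) (dir b)
    a≢k = proj₁ (third-≢ (dir a) (dir b))
    b≢k = proj₂ (third-≢ (dir a) (dir b))
    S = a ∷ b ∷ []
    S⊆H : S ⊆ H
    S⊆H (here refl)         = a∈
    S⊆H (there (here refl)) = b∈
    dir≢k : ∀ {h} → h ∈ H → dir h ≢ k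
    dir≢k h∈ with covers h∈
    ... | inj₁ meets-a = a≢k ∘ trans (intersecting⇒dir≡ a∈ h∈ meets-a)
    ... | inj₂ meets-b = b≢k ∘ trans (intersecting⇒dir≡ b∈ h∈ meets-b)
    along-k≡[] : along k ≡ []
    along-k≡[] = filter-none (λ h → dir h ≟ k) (All.tabulate dir≢k)
    across-k≡S : across k S ≡ S
    across-k≡S = filter-all (λ x → ¬? (dir x ≟ k)) (a≢k ∷ b≢k ∷ [])

  intersecting⇒length≤size : ∀ {a} → a ∈ H → (∀ {h} → h ∈ H → ¬ Disjoint a h) → length H ≤ size (dir a)
  intersecting⇒length≤size {a} a∈ meets =
    subst (_≤ size (dir a)) (cong length along≡H) (≤-trans (m≤m+n _ _) (load-bound {[]} (λ ()) [] (dir a)))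
    where
    along≡H : along (dir a) ≡ H
    along≡H =
      filter-all (λ h → dir h ≟ dir a) (All.tabulate λ h∈ → sym (intersecting⇒dir≡ a∈ h∈ (meets h∈)))

  length-bound : (∃[ p ] length H ≤ size p)
               ⊎ (∃[ k ] length H + 2 + size k ≤ ∑ size)
               ⊎ length H + 6 ≤ ∑ size
  length-bound with Any.any? (λ a → Any.any? (λ b → Any.any? (λ c →
                                    disjoint? a b ×-dec disjoint? a c ×-dec disjoint? b c) H) H) H
  ... | yes ∃abc =
    let a , a∈ , ∃bc = find ∃abc
        b , b∈ , ∃c  = find ∃bc
        c , c∈ , (ab , ac , bc) = find ∃c
    in inj₂ (inj₂ (disjoint-triple⇒length+6≤ a∈ b∈ c∈ ab ac bc))
  ... | no ∄abc with Any.any? (λ a → Any.any? (λ b → disjoint? a b) H) H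
  ...   | yes ∃ab with find ∃ab
  ...     | a , a∈ , ∃b with find ∃b
  ...       | b , b∈ , ab = inj₂ (inj₁ (covering-disjoint-pair⇒length+2+size≤ a∈ b∈ ab covers))
    where
    covers : ∀ {h} → h ∈ H → ¬ Disjoint a h ⊎ ¬ Disjoint b h
    covers {h} h∈ with disjoint? a h | disjoint? b h
    ... | no ¬ah | _      = inj₁ ¬ah
    ... | yes _  | no ¬bh = inj₂ ¬bh
    ... | yes ah | yes bh = ⊥-elim (∄abc (lose a∈ (lose b∈ (lose h∈ (ab , ah , bh)))))
  length-bound | no ∄abc | no ∄ab with []⊎∈ H
  ... | inj₁ H≡[]     = inj₁ (0F , subst (_≤ n₁) (cong length (sym H≡[])) z≤n)
  ... | inj₂ (a , a∈) = inj₁ (dir a , intersecting⇒length≤size a∈ λ h∈ ah → ∄ab (lose a∈ (lose h∈ ah)))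

-- Written 4 ⊓ n₃ rather than n₃ ⊓ 4 so that it computes for n₃ = 4 + k.
deficit : ℕ → ℕ
deficit n₃ = 2 + 4 ⊓ n₃

n₁+deficit≤ : ∀ {n₁ n₂ n₃} → 2 ≤ n₂ → n₁ + deficit n₃ ≤ n₁ + n₂ + n₃
n₁+deficit≤ {n₁} {n₂} {n₃} 2≤n₂ =
  subst (n₁ + deficit n₃ ≤_) (sym (+-assoc n₁ n₂ n₃)) (+-monoʳ-≤ n₁ (+-mono-≤ 2≤n₂ (m⊓n≤n 4 n₃)))

exValue+deficit : ∀ {n₁ n₂ n₃} → 2 ≤ n₂ → 2 ≤ n₃ → exValue n₁ n₂ n₃ + deficit n₃ ≡ n₁ + n₂ + n₃
exValue+deficit {n₃ = 0} _ ()
exValue+deficit {n₃ = 1} _ (s≤s ())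
exValue+deficit {n₁} {n₃ = 2}                       2≤n₂ _ = m∸n+n≡m (≤-trans (m≤n+m _ n₁) (n₁+deficit≤ 2≤n₂))
exValue+deficit {n₁} {n₃ = 3}                       2≤n₂ _ = m∸n+n≡m (≤-trans (m≤n+m _ n₁) (n₁+deficit≤ 2≤n₂))
exValue+deficit {n₁} {n₃ = suc (suc (suc (suc _)))} 2≤n₂ _ = m∸n+n≡m (≤-trans (m≤n+m _ n₁) (n₁+deficit≤ 2≤n₂))

≤exValue : ∀ {n₁ n₂ n₃ L} → 2 ≤ n₂ → 2 ≤ n₃ → L + deficit n₃ ≤ n₁ + n₂ + n₃ → L ≤ exValue n₁ n₂ n₃
≤exValue {n₃ = n₃} {L} 2≤n₂ 2≤n₃ le =
  +-cancelʳ-≤ (deficit n₃) L _ (subst (L + deficit n₃ ≤_) (sym (exValue+deficit 2≤n₂ 2≤n₃)) le)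

length+deficit≤ : ∀ {n₁ n₂ n₃} → n₂ ≤ n₁ → n₃ ≤ n₂ → 2 ≤ n₃ → ∀ {H : List (Edge n₁ n₂ n₃)} →
  Unique H → F₃-free H → length H + deficit n₃ ≤ n₁ + n₂ + n₃
length+deficit≤ {n₁} {n₂} {n₃} n₂≤n₁ n₃≤n₂ 2≤n₃ {H} H-unique H-free
  with FreeFamily.length-bound H-unique H-free
... | inj₁ (p , H≤size) =
  ≤-trans (+-monoˡ-≤ (deficit n₃) (≤-trans H≤size (size≤n₁ n₂≤n₁ n₃≤n₂ p)))
          (n₁+deficit≤ (≤-trans 2≤n₃ n₃≤n₂))
  where open Edges n₁ n₂ n₃
... | inj₂ (inj₁ (k , H+2+size≤)) =
  ≤-trans (≤-reflexive (sym (+-assoc (length H) 2 (4 ⊓ n₃))))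
          (≤-trans (+-monoʳ-≤ (length H + 2) (≤-trans (m⊓n≤n 4 n₃) (n₃≤size n₂≤n₁ n₃≤n₂ k))) H+2+size≤)
  where open Edges n₁ n₂ n₃
... | inj₂ (inj₂ H+6≤) = ≤-trans (+-monoʳ-≤ (length H) (s≤s (s≤s (m⊓n≤m 4 n₃)))) H+6≤

FamilyOfSize : ℕ → ℕ → ℕ → ℕ → Set
FamilyOfSize n₁ n₂ n₃ m = ∃[ H ] (Unique H × F₃-free {n₁} {n₂} {n₃} H × length H ≡ m)

labelled-family : ∀ {n₁ n₂ n₃ m} (f : Fin m → Edge n₁ n₂ n₃) → (∀ {i j} → f i ≡ f j → i ≡ j) →
  (∀ i j → ∣ f i ∩ f j ∣ ≢ 1) → FamilyOfSize n₁ n₂ n₃ m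
labelled-family {m = m} f f-injective never-once =
  map f (allFin m) , Unique.map⁺ f-injective (Unique.allFin⁺ m) , free ,
  trans (length-map f (allFin m)) (length-tabulate id)
  where
  free : F₃-free (map f (allFin m))
  free h∈ g∈ with ∈-map⁻ f h∈ | ∈-map⁻ f g∈
  ... | i , _ , refl | j , _ , refl = never-once i j

splitAt-injective : ∀ m {n} {i j : Fin (m + n)} → splitAt m i ≡ splitAt m j → i ≡ j
splitAt-injective m {n} {i} {j} eq = begin
  i                       ≡⟨ join-splitAt m n i ⟨
  join m n (splitAt m i)  ≡⟨ cong (join m n) eq ⟩
  join m n (splitAt m j)  ≡⟨ join-splitAt m n j ⟩
  j                       ∎
  where open ≡-Reasoning

map₂-injective : ∀ {A B C : Set} {f : B → C} → (∀ {x y} → f x ≡ f y → x ≡ y) →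
  ∀ {u v : A ⊎ B} → Sum.map₂ f u ≡ Sum.map₂ f v → u ≡ v
map₂-injective f-injective {inj₁ _} {inj₁ _} refl = refl
map₂-injective f-injective {inj₂ _} {inj₂ _} e    = cong inj₂ (f-injective (inj₂-injective e))
map₂-injective f-injective {inj₁ _} {inj₂ _} ()
map₂-injective f-injective {inj₂ _} {inj₁ _} ()

two-stars : ∀ {a b c} → Fin a ⊎ Fin b → Edge (suc a) (suc b) (suc (suc c))
two-stars (inj₁ i) = suc i , 0F , 0F
two-stars (inj₂ j) = 0F , suc j , 1F

two-stars-family : ∀ a b c → FamilyOfSize (suc a) (suc b) (suc (suc c)) (a + b)
two-stars-family a b c =
  labelled-family (two-stars ∘ splitAt a) (splitAt-injective a ∘ injective)
                  (λ i j → never-once (splitAt a i) (splitAt a j))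
  where
  open Edges (suc a) (suc b) (suc (suc c))
  injective : ∀ {x y} → two-stars x ≡ two-stars y → x ≡ y
  injective {inj₁ _} {inj₁ _} e = cong inj₁ (suc-injective (cong (coord 0F) e))
  injective {inj₂ _} {inj₂ _} e = cong inj₂ (suc-injective (cong (coord 1F) e))
  never-once : ∀ x y → ∣ two-stars x ∩ two-stars y ∣ ≢ 1
  never-once x@(inj₁ _) y@(inj₁ _) = two-agreements⇒∣∩∣≢1 {1F} {2F} (two-stars x) (two-stars y) (λ ()) refl refl
  never-once x@(inj₂ _) y@(inj₂ _) = two-agreements⇒∣∩∣≢1 {0F} {2F} (two-stars x) (two-stars y) (λ ()) refl refl
  never-once (inj₁ _) (inj₂ _) = λ ()
  never-once (inj₂ _) (inj₁ _) = λ ()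

three-stars : ∀ {a b c} → Fin a ⊎ Fin b ⊎ Fin c → Edge (suc (suc a)) (suc (suc b)) (suc (suc c))
three-stars (inj₁ i)        = suc (suc i) , 0F , 0F
three-stars (inj₂ (inj₁ j)) = 0F , suc (suc j) , 1F
three-stars (inj₂ (inj₂ k)) = 1F , 1F , suc (suc k)

three-stars-family : ∀ a b c → FamilyOfSize (suc (suc a)) (suc (suc b)) (suc (suc c)) (a + (b + c))
three-stars-family a b c =
  labelled-family (three-stars ∘ label) (label-injective ∘ injective)
                  (λ i j → never-once (label i) (label j))
  where
  open Edges (suc (suc a)) (suc (suc b)) (suc (suc c))
  label : Fin (a + (b + c)) → Fin a ⊎ Fin b ⊎ Fin c
  label = Sum.map₂ (splitAt b) ∘ splitAt a
  label-injective : ∀ {i j} → label i ≡ label j → i ≡ j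
  label-injective = splitAt-injective a ∘ map₂-injective (splitAt-injective b)
  injective : ∀ {x y} → three-stars x ≡ three-stars y → x ≡ y
  injective {inj₁ _}        {inj₁ _}        e = cong inj₁ (suc-injective (suc-injective (cong (coord 0F) e)))
  injective {inj₂ (inj₁ _)} {inj₂ (inj₁ _)} e =
    cong (inj₂ ∘ inj₁) (suc-injective (suc-injective (cong (coord 1F) e)))
  injective {inj₂ (inj₂ _)} {inj₂ (inj₂ _)} e =
    cong (inj₂ ∘ inj₂) (suc-injective (suc-injective (cong (coord 2F) e)))
  injective {inj₁ _}        {inj₂ (inj₁ _)} ()
  injective {inj₁ _}        {inj₂ (inj₂ _)} ()
  injective {inj₂ (inj₁ _)} {inj₁ _}        ()
  injective {inj₂ (inj₁ _)} {inj₂ (inj₂ _)} ()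
  injective {inj₂ (inj₂ _)} {inj₁ _}        ()
  injective {inj₂ (inj₂ _)} {inj₂ (inj₁ _)} ()
  never-once : ∀ x y → ∣ three-stars x ∩ three-stars y ∣ ≢ 1
  never-once x@(inj₁ _)        y@(inj₁ _)        =
    two-agreements⇒∣∩∣≢1 {1F} {2F} (three-stars x) (three-stars y) (λ ()) refl refl
  never-once x@(inj₂ (inj₁ _)) y@(inj₂ (inj₁ _)) =
    two-agreements⇒∣∩∣≢1 {0F} {2F} (three-stars x) (three-stars y) (λ ()) refl refl
  never-once x@(inj₂ (inj₂ _)) y@(inj₂ (inj₂ _)) =
    two-agreements⇒∣∩∣≢1 {0F} {1F} (three-stars x) (three-stars y) (λ ()) refl refl
  never-once (inj₁ _)        (inj₂ (inj₁ _)) = λ ()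
  never-once (inj₁ _)        (inj₂ (inj₂ _)) = λ ()
  never-once (inj₂ (inj₁ _)) (inj₁ _)        = λ ()
  never-once (inj₂ (inj₁ _)) (inj₂ (inj₂ _)) = λ ()
  never-once (inj₂ (inj₂ _)) (inj₁ _)        = λ ()
  never-once (inj₂ (inj₂ _)) (inj₂ (inj₁ _)) = λ ()

resize-to-exValue : ∀ {n₁ n₂ n₃ L} → 2 ≤ n₂ → 2 ≤ n₃ → L + deficit n₃ ≡ n₁ + n₂ + n₃ →
  FamilyOfSize n₁ n₂ n₃ L → FamilyOfSize n₁ n₂ n₃ (exValue n₁ n₂ n₃)
resize-to-exValue {n₁} {n₂} {n₃} {L} 2≤n₂ 2≤n₃ L+deficit≡ =
  subst (FamilyOfSize n₁ n₂ n₃)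
        (+-cancelʳ-≡ (deficit n₃) L _ (trans L+deficit≡ (sym (exValue+deficit 2≤n₂ 2≤n₃))))

extremal-family : ∀ {n₁ n₂ n₃} → n₂ ≤ n₁ → n₃ ≤ n₂ → 2 ≤ n₃ → FamilyOfSize n₁ n₂ n₃ (exValue n₁ n₂ n₃)
extremal-family {n₃ = 0} _ _ ()
extremal-family {n₃ = 1} _ _ (s≤s ())
extremal-family {suc (suc a)} {suc (suc b)} {2} (s≤s (s≤s _)) (s≤s (s≤s _)) 2≤n₃ =
  resize-to-exValue (s≤s (s≤s z≤n)) 2≤n₃ (size a b) (two-stars-family (suc a) (suc b) 0)
  where
  size : ∀ a b → suc a + suc b + 4 ≡ suc (suc a) + suc (suc b) + 2
  size = solve-∀
extremal-family {suc (suc a)} {suc (suc b)} {3} (s≤s (s≤s _)) (s≤s (s≤s _)) 2≤n₃ =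
  resize-to-exValue (s≤s (s≤s z≤n)) 2≤n₃ (size a b) (two-stars-family (suc a) (suc b) 1)
  where
  size : ∀ a b → suc a + suc b + 5 ≡ suc (suc a) + suc (suc b) + 3
  size = solve-∀
extremal-family {suc (suc a)} {suc (suc b)} {suc (suc (suc (suc k)))} (s≤s (s≤s _)) (s≤s (s≤s _)) 2≤n₃ =
  resize-to-exValue (s≤s (s≤s z≤n)) 2≤n₃ (size a b k) (three-stars-family a b (suc (suc k)))
  where
  size : ∀ a b k → a + (b + suc (suc k)) + 6 ≡ suc (suc a) + suc (suc b) + suc (suc (suc (suc k)))
  size = solve-∀

proposition6p1 : ∀ (n₁ n₂ n₃ : ℕ) → n₂ ≤ n₁ → n₃ ≤ n₂ → 2 ≤ n₃ →
    IsEx n₁ n₂ n₃ (exValue n₁ n₂ n₃)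
proposition6p1 n₁ n₂ n₃ n₂≤n₁ n₃≤n₂ 2≤n₃ =
  extremal-family n₂≤n₁ n₃≤n₂ 2≤n₃ ,
  λ H H-unique H-free → ≤exValue 2≤n₂ 2≤n₃ (length+deficit≤ n₂≤n₁ n₃≤n₂ 2≤n₃ H-unique H-free)
  where
  2≤n₂ : 2 ≤ n₂
  2≤n₂ = ≤-trans 2≤n₃ n₃≤n₂
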